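{- Let $n,m$ be integers with $n\geq m\geq 1$. Then (i) $C_{n+m-1}-C_{n-m}=2c_nc_m$; (ii) $C_{n+m-1}+C_{n-m}=16b_nb_m+8(b_n+b_m)+4$.
   Context: The Lucas-balancing numbers $C_k$ ($k\ge0$) are defined by $C_0=1$, $C_1=3$, $C_{k+1}=6C_k-C_{k-1}$ for $k\ge1$. The cobalancing numbers $b_k$ ($k\ge1$) are defined by $b_1=0$, $b_2=2$, $b_{k+1}=6b_k-b_{k-1}+2$ for $k\ge2$. The Lucas-cobalancing numbers $c_k$ ($k\ge1$) are defined by $c_1=1$, $c_2=7$, $c_{k+1}=6c_k-c_{k-1}$ for $k\ge2$. -}

module Defs where

open import Data.Nat using (ℕ; zero; suc)
open import Data.Integer using (ℤ; +_; _+_; _-_; _*_)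

C : ℕ → ℤ
C zero = + 1
C (suc zero) = + 3
C (suc (suc k)) = + 6 * C (suc k) - C k

-- Cobalancing numbers (defined for k ≥ 1): b 1 = 0, b 2 = 2,
-- b (k+1) = 6 b k - b (k-1) + 2 for k ≥ 2.  The value at index 0 is a
-- junk value (0) and is never used by the recursion for k ≥ 1.
b : ℕ → ℤ
b zero = + 0
b (suc zero) = + 0
b (suc (suc zero)) = + 2
b (suc (suc (suc k))) = + 6 * b (suc (suc k)) - b (suc k) + + 2

-- Lucas-cobalancing numbers (defined for k ≥ 1): c 1 = 1, c 2 = 7,
-- c (k+1) = 6 c k - c (k-1) for k ≥ 2.  Index 0 is a junk value (0).
c : ℕ → ℤ
c zero = + 0
c (suc zero) = + 1
c (suc (suc zero)) = + 7
c (suc (suc (suc k))) = + 6 * c (suc (suc k)) - c (suc k)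

module Submission where

-- Write (1 + √2)^k = H k + P k √2 with integers H k, P k.
-- Since (1 + √2)^2 = 3 + 2√2 and (3 + 2√2)^2 = 6 (3 + 2√2) - 1, every
-- second term of H (and of P) satisfies the recurrence u (k+2) = 6 u (k+1) - u k
-- shared by C, c and 2 b + 1.  Comparing initial values identifies
--   C k = H (2k),   c (k+1) = H (2k+1),   2 b (k+1) + 1 = P (2k+1).
-- The addition law (1+√2)^(x+y) = (1+√2)^x (1+√2)^y and the norm
-- H y ^ 2 - 2 P y ^ 2 = (-1)^y give, for every x and odd y,
--   H (x + 2y) - H x = 2 H (x + y) H y,   H (x + 2y) + H x = 4 P (x + y) P y.
-- With n = m + d, x = 2d and y = 2m - 1 these are exactly (i) and (ii),
-- since 16 b_n b_m + 8 (b_n + b_m) + 4 = 4 (2 b_n + 1) (2 b_m + 1).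

open import Defs
open import Data.Nat using (ℕ; _≤_; _∸_; zero; suc; s≤s; z≤n)
import Data.Nat as N
open import Data.Nat.Properties using (m≤n⇒∃[o]m+o≡n; m+n∸m≡n)
import Data.Nat.Tactic.RingSolver as ℕ-Solver
open import Data.Integer using (ℤ; +_; _+_; _-_; _*_; -_; 0ℤ; -1ℤ)
open import Data.Integer.Properties using (neg-involutive; +-identityʳ; *-zeroʳ)
open import Data.Integer.Tactic.RingSolver using (solve-∀)
open import Data.Product using (_×_; _,_; proj₁; proj₂)
open import Relation.Binary.PropositionalEquality
  using (_≡_; refl; sym; cong; cong₂; module ≡-Reasoning)
open ≡-Reasoning

-- The Pell pair: H k + P k √2 = (1 + √2)^k, multiplication by 1 + √2
-- being (h, p) ↦ (h + 2p, h + p).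
H : ℕ → ℤ
P : ℕ → ℤ
H zero    = + 1
H (suc k) = H k + + 2 * P k
P zero    = + 0
P (suc k) = H k + P k

pell-add : ∀ x y → (H (x N.+ y) ≡ H x * H y + + 2 * P x * P y)
                 × (P (x N.+ y) ≡ P x * H y + H x * P y)
pell-add zero y = unitˡ-H (H y) (P y) , unitˡ-P (H y) (P y)
  where
  unitˡ-H : ∀ h p → h ≡ + 1 * h + + 2 * + 0 * p
  unitˡ-H = solve-∀
  unitˡ-P : ∀ h p → p ≡ + 0 * h + + 1 * p
  unitˡ-P = solve-∀
pell-add (suc x) y with pell-add x y
... | eqH , eqP =
    (begin
      H (x N.+ y) + + 2 * P (x N.+ y)       ≡⟨ cong₂ (λ u v → u + + 2 * v) eqH eqP ⟩
      (H x * H y + + 2 * P x * P y) + + 2 * (P x * H y + H x * P y)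
                                             ≡⟨ step-H (H x) (P x) (H y) (P y) ⟩
      H (suc x) * H y + + 2 * P (suc x) * P y ∎)
  , (begin
      H (x N.+ y) + P (x N.+ y)             ≡⟨ cong₂ _+_ eqH eqP ⟩
      (H x * H y + + 2 * P x * P y) + (P x * H y + H x * P y)
                                             ≡⟨ step-P (H x) (P x) (H y) (P y) ⟩
      P (suc x) * H y + H (suc x) * P y     ∎)
  where
  step-H : ∀ hx px hy py →
    (hx * hy + + 2 * px * py) + + 2 * (px * hy + hx * py)
      ≡ (hx + + 2 * px) * hy + + 2 * (hx + px) * py
  step-H = solve-∀
  step-P : ∀ hx px hy py →
    (hx * hy + + 2 * px * py) + (px * hy + hx * py)
      ≡ (hx + px) * hy + (hx + + 2 * px) * py
  step-P = solve-∀

H-add : ∀ x y → H (x N.+ y) ≡ H x * H y + + 2 * P x * P y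
H-add x y = proj₁ (pell-add x y)

P-add : ∀ x y → P (x N.+ y) ≡ P x * H y + H x * P y
P-add x y = proj₂ (pell-add x y)

-- The norm H k ^ 2 - 2 P k ^ 2 of (1+√2)^k; it changes sign at each step
-- because 1 + √2 has norm -1, hence equals -1 at odd indices.
norm : ℕ → ℤ
norm k = H k * H k - + 2 * P k * P k

norm-suc : ∀ k → norm (suc k) ≡ - norm k
norm-suc k = flip (H k) (P k)
  where
  flip : ∀ h p → (h + + 2 * p) * (h + + 2 * p) - + 2 * (h + p) * (h + p)
                 ≡ - (h * h - + 2 * p * p)
  flip = solve-∀

norm-odd : ∀ k → norm (1 N.+ 2 N.* k) ≡ -1ℤ
norm-odd zero    = refl
norm-odd (suc k) = begin
  norm (1 N.+ 2 N.* suc k)          ≡⟨ cong norm (index k) ⟩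
  norm (suc (suc (1 N.+ 2 N.* k)))  ≡⟨ norm-suc (suc (1 N.+ 2 N.* k)) ⟩
  - norm (suc (1 N.+ 2 N.* k))      ≡⟨ cong -_ (norm-suc (1 N.+ 2 N.* k)) ⟩
  - - norm (1 N.+ 2 N.* k)          ≡⟨ neg-involutive (norm (1 N.+ 2 N.* k)) ⟩
  norm (1 N.+ 2 N.* k)              ≡⟨ norm-odd k ⟩
  -1ℤ                               ∎
  where
  index : ∀ k → 1 N.+ 2 N.* suc k ≡ 2 N.+ (1 N.+ 2 N.* k)
  index = ℕ-Solver.solve-∀

Recurrence : (ℕ → ℤ) → Set
Recurrence u = ∀ k → u (suc (suc k)) ≡ + 6 * u (suc k) - u k

recurrence-unique : ∀ u v → Recurrence u → Recurrence v →
  u 0 ≡ v 0 → u 1 ≡ v 1 → ∀ k → u k ≡ v k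
recurrence-unique u v recU recV eq₀ eq₁ = agree
  where
  agree : ∀ k → u k ≡ v k
  agree zero          = eq₀
  agree (suc zero)    = eq₁
  agree (suc (suc k)) = begin
    u (suc (suc k))          ≡⟨ recU k ⟩
    + 6 * u (suc k) - u k    ≡⟨ cong₂ (λ s t → + 6 * s - t) (agree (suc k)) (agree k) ⟩
    + 6 * v (suc k) - v k    ≡⟨ sym (recV k) ⟩
    v (suc (suc k))          ∎

-- (1+√2)^4 = 6 (1+√2)^2 - 1, so H and P satisfy the recurrence with step 2.
H-step2 : ∀ j → H (4 N.+ j) ≡ + 6 * H (2 N.+ j) - H j
H-step2 j = quartic (H j) (P j)
  where
  quartic : ∀ (h p : ℤ) →
    let h1 = h + + 2 * p ; p1 = h + p
        h2 = h1 + + 2 * p1 ; p2 = h1 + p1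
        h3 = h2 + + 2 * p2 ; p3 = h2 + p2
    in h3 + + 2 * p3 ≡ + 6 * (h1 + + 2 * p1) - h
  quartic = solve-∀

P-step2 : ∀ j → P (4 N.+ j) ≡ + 6 * P (2 N.+ j) - P j
P-step2 j = quartic (H j) (P j)
  where
  quartic : ∀ (h p : ℤ) →
    let h1 = h + + 2 * p ; p1 = h + p
        h2 = h1 + + 2 * p1 ; p2 = h1 + p1
        h3 = h2 + + 2 * p2 ; p3 = h2 + p2
    in h3 + p3 ≡ + 6 * (h1 + p1) - p
  quartic = solve-∀

step2-recurrence : (f : ℕ → ℤ) → (∀ j → f (4 N.+ j) ≡ + 6 * f (2 N.+ j) - f j) →
  ∀ r → Recurrence (λ k → f (r N.+ 2 N.* k))
step2-recurrence f f-step2 r k = begin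
  f (r N.+ 2 N.* suc (suc k))        ≡⟨ cong f (index₂ r k) ⟩
  f (4 N.+ (r N.+ 2 N.* k))          ≡⟨ f-step2 (r N.+ 2 N.* k) ⟩
  + 6 * f (2 N.+ (r N.+ 2 N.* k)) - f (r N.+ 2 N.* k)
                                     ≡⟨ cong (λ i → + 6 * f i - f (r N.+ 2 N.* k)) (index₁ r k) ⟩
  + 6 * f (r N.+ 2 N.* suc k) - f (r N.+ 2 N.* k) ∎
  where
  index₂ : ∀ r k → r N.+ 2 N.* suc (suc k) ≡ 4 N.+ (r N.+ 2 N.* k)
  index₂ = ℕ-Solver.solve-∀
  index₁ : ∀ r k → 2 N.+ (r N.+ 2 N.* k) ≡ r N.+ 2 N.* suc k
  index₁ = ℕ-Solver.solve-∀

C≡H : ∀ k → C k ≡ H (2 N.* k)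
C≡H = recurrence-unique C (λ k → H (0 N.+ 2 N.* k))
        (λ k → refl) (step2-recurrence H H-step2 0) refl refl

c≡H : ∀ k → c (suc k) ≡ H (1 N.+ 2 N.* k)
c≡H = recurrence-unique (λ k → c (suc k)) (λ k → H (1 N.+ 2 N.* k))
        c-recurrence (step2-recurrence H H-step2 1) refl refl
  where
  c-recurrence : Recurrence (λ k → c (suc k))
  c-recurrence zero    = refl
  c-recurrence (suc k) = refl

b≡P : ∀ k → + 2 * b (suc k) + + 1 ≡ P (1 N.+ 2 N.* k)
b≡P = recurrence-unique (λ k → + 2 * b (suc k) + + 1) (λ k → P (1 N.+ 2 N.* k))
        b-recurrence (step2-recurrence P P-step2 1) refl refl
  where
  affine : ∀ (x y : ℤ) →
    + 2 * (+ 6 * x - y + + 2) + + 1 ≡ + 6 * (+ 2 * x + + 1) - (+ 2 * y + + 1)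
  affine = solve-∀
  b-recurrence : Recurrence (λ k → + 2 * b (suc k) + + 1)
  b-recurrence zero    = refl
  b-recurrence (suc k) = affine (b (suc (suc (suc k)))) (b (suc (suc k)))

-- The two identities for H, valid whenever the norm at y is -1.  After
-- expanding H (x + 2y) by the addition law they are polynomial identities
-- modulo the relation H y ^ 2 - 2 P y ^ 2 = -1.
module _ (x y : ℕ) (unit : norm y ≡ -1ℤ) where

  private
    shifted : ℤ
    shifted = H x * (H y * H y + + 2 * P y * P y) + + 2 * P x * (P y * H y + H y * P y)

    H-shift : H (x N.+ (y N.+ y)) ≡ shifted
    H-shift = begin
      H (x N.+ (y N.+ y))                                 ≡⟨ H-add x (y N.+ y) ⟩
      H x * H (y N.+ y) + + 2 * P x * P (y N.+ y)
        ≡⟨ cong₂ (λ s t → H x * s + + 2 * P x * t) (H-add y y) (P-add y y) ⟩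
      H x * (H y * H y + + 2 * P y * P y) + + 2 * P x * (P y * H y + H y * P y) ∎

    -- The norm relation enters only through the factor  norm y + 1 = 0.
    norm-excess : H x * (norm y - -1ℤ) ≡ 0ℤ
    norm-excess = begin
      H x * (norm y - -1ℤ)   ≡⟨ cong (λ t → H x * (t - -1ℤ)) unit ⟩
      H x * 0ℤ               ≡⟨ *-zeroʳ (H x) ⟩
      0ℤ                     ∎

  H-difference : H (x N.+ (y N.+ y)) - H x ≡ + 2 * H (x N.+ y) * H y
  H-difference = begin
    H (x N.+ (y N.+ y)) - H x               ≡⟨ cong (_- H x) H-shift ⟩
    shifted - H x                            ≡⟨ expand (H x) (P x) (H y) (P y) ⟩
    leading - H x * (norm y - -1ℤ)          ≡⟨ cong (λ t → leading - t) norm-excess ⟩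
    leading - 0ℤ                             ≡⟨ +-identityʳ leading ⟩
    + 2 * (H x * H y + + 2 * P x * P y) * H y
                                             ≡⟨ cong (λ s → + 2 * s * H y) (sym (H-add x y)) ⟩
    + 2 * H (x N.+ y) * H y                 ∎
    where
    leading : ℤ
    leading = + 2 * (H x * H y + + 2 * P x * P y) * H y
    expand : ∀ hx px hy py →
      (hx * (hy * hy + + 2 * py * py) + + 2 * px * (py * hy + hy * py)) - hx
        ≡ + 2 * (hx * hy + + 2 * px * py) * hy - hx * ((hy * hy - + 2 * py * py) - -1ℤ)
    expand = solve-∀

  H-sum : H (x N.+ (y N.+ y)) + H x ≡ + 4 * P (x N.+ y) * P y
  H-sum = begin
    H (x N.+ (y N.+ y)) + H x               ≡⟨ cong (_+ H x) H-shift ⟩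
    shifted + H x                            ≡⟨ expand (H x) (P x) (H y) (P y) ⟩
    leading + H x * (norm y - -1ℤ)          ≡⟨ cong (λ t → leading + t) norm-excess ⟩
    leading + 0ℤ                             ≡⟨ +-identityʳ leading ⟩
    + 4 * (P x * H y + H x * P y) * P y     ≡⟨ cong (λ s → + 4 * s * P y) (sym (P-add x y)) ⟩
    + 4 * P (x N.+ y) * P y                 ∎
    where
    leading : ℤ
    leading = + 4 * (P x * H y + H x * P y) * P y
    expand : ∀ hx px hy py →
      (hx * (hy * hy + + 2 * py * py) + + 2 * px * (py * hy + hy * py)) + hx
        ≡ + 4 * (px * hy + hx * py) * py + hx * ((hy * hy - + 2 * py * py) - -1ℤ)
    expand = solve-∀

-- The theorem with n = k + 1 + d and m = k + 1, i.e. x = 2d, y = 2k + 1.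
-- The index bookkeeping: 2 (n + m - 1) = x + 2y and 2n - 1 = x + y.
module _ (k d : ℕ) where

  private
    x y : ℕ
    x = 2 N.* d
    y = 1 N.+ 2 N.* k

    C-top : C (k N.+ d N.+ suc k) ≡ H (x N.+ (y N.+ y))
    C-top = begin
      C (k N.+ d N.+ suc k)         ≡⟨ C≡H (k N.+ d N.+ suc k) ⟩
      H (2 N.* (k N.+ d N.+ suc k)) ≡⟨ cong H (index k d) ⟩
      H (x N.+ (y N.+ y))           ∎
      where
      index : ∀ k d → 2 N.* (k N.+ d N.+ suc k) ≡ 2 N.* d N.+ ((1 N.+ 2 N.* k) N.+ (1 N.+ 2 N.* k))
      index = ℕ-Solver.solve-∀

    middle : 1 N.+ 2 N.* (k N.+ d) ≡ x N.+ y
    middle = index k d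
      where
      index : ∀ k d → 1 N.+ 2 N.* (k N.+ d) ≡ 2 N.* d N.+ (1 N.+ 2 N.* k)
      index = ℕ-Solver.solve-∀

  lucas-difference : C (k N.+ d N.+ suc k) - C d ≡ + 2 * c (suc (k N.+ d)) * c (suc k)
  lucas-difference = begin
    C (k N.+ d N.+ suc k) - C d          ≡⟨ cong₂ _-_ C-top (C≡H d) ⟩
    H (x N.+ (y N.+ y)) - H x            ≡⟨ H-difference x y (norm-odd k) ⟩
    + 2 * H (x N.+ y) * H y              ≡⟨ cong₂ (λ s t → + 2 * H s * t) (sym middle) (sym (c≡H k)) ⟩
    + 2 * H (1 N.+ 2 N.* (k N.+ d)) * c (suc k)
                                          ≡⟨ cong (λ s → + 2 * s * c (suc k)) (sym (c≡H (k N.+ d))) ⟩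
    + 2 * c (suc (k N.+ d)) * c (suc k)  ∎

  lucas-sum : C (k N.+ d N.+ suc k) + C d
            ≡ + 16 * b (suc (k N.+ d)) * b (suc k) + + 8 * (b (suc (k N.+ d)) + b (suc k)) + + 4
  lucas-sum = begin
    C (k N.+ d N.+ suc k) + C d          ≡⟨ cong₂ _+_ C-top (C≡H d) ⟩
    H (x N.+ (y N.+ y)) + H x            ≡⟨ H-sum x y (norm-odd k) ⟩
    + 4 * P (x N.+ y) * P y              ≡⟨ cong₂ (λ s t → + 4 * P s * t) (sym middle) (sym (b≡P k)) ⟩
    + 4 * P (1 N.+ 2 N.* (k N.+ d)) * (+ 2 * b (suc k) + + 1)
      ≡⟨ cong (λ s → + 4 * s * (+ 2 * b (suc k) + + 1)) (sym (b≡P (k N.+ d))) ⟩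
    + 4 * (+ 2 * b (suc (k N.+ d)) + + 1) * (+ 2 * b (suc k) + + 1)
      ≡⟨ factor (b (suc (k N.+ d))) (b (suc k)) ⟩
    + 16 * b (suc (k N.+ d)) * b (suc k) + + 8 * (b (suc (k N.+ d)) + b (suc k)) + + 4 ∎
    where
    factor : ∀ (s t : ℤ) →
      + 4 * (+ 2 * s + + 1) * (+ 2 * t + + 1) ≡ + 16 * s * t + + 8 * (s + t) + + 4
    factor = solve-∀

mainTheorem5 : (n m : ℕ) → 1 ≤ m → m ≤ n →
    (C (n Data.Nat.+ m ∸ 1) - C (n ∸ m) ≡ + 2 * c n * c m)
    × (C (n Data.Nat.+ m ∸ 1) + C (n ∸ m) ≡ + 16 * b n * b m + + 8 * (b n + b m) + + 4)
mainTheorem5 n (suc k) (s≤s z≤n) m≤n with m≤n⇒∃[o]m+o≡n m≤n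
... | d , refl rewrite m+n∸m≡n k d = lucas-difference k d , lucas-sum k d
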